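{- Let $S_0,S_1,\ldots$ be a saturation. Suppose $(C\circ R)\in S_i$, $\theta$ is a substitution grounding for $C$, and $\theta\models R$. Then $C\theta$ is redundant with respect to $S_i^*$.
   Context: Work in first-order logic with equality $\approx$ over a finite signature $\Sigma$ with at least one constant. Literals are unordered $s\approx t$ or $s\not\approx t$ ($s\doteq t$ for either); clauses are finite multisets of literals. Fix a simplification order $\succ$ on terms (well-founded, closed under substitutions and contexts, subterm property, total on ground terms), extended to literals ($s\approx t\mapsto\{s,t\}$, $s\not\approx t\mapsto\{s,s,t,t\}$, multiset extension) and clauses (multiset extension). A ground clause $D$ is redundant w.r.t. a set $S$ of ground clauses if there are $C_1,\ldots,C_n\in S$ with $C_1,\ldots,C_n\models D$ and $D\succ C_i$ for all $i$. Redundancy formulas are first-order formulas over the structure $T_{\mathcal R}(\Sigma)$ whose universe is the set of ground terms (each denoting itself, $=$ syntactic identity) with finitely many fixed-interpretation predicates including $\succ$; $\bot$ is the false formula. Abbreviations: $s\succeq t$ is $s\succ t\lor s=t$; for $L=s\doteq t$, $L\succ l$ is $s\succ l\lor t\succ l$, $L\succeq l$ is $s\succeq l\lor t\succeq l$; for a clause, $C\succ l$ and $C\succeq l$ are the disjunctions over its literals. A partial clause $C\circ R$ is a clause with a redundancy formula whose free variables occur in $C$. $\sigma\models R$ means every ground instance of $R\sigma$ holds in $T_{\mathcal R}(\Sigma)$; $\sigma\not\models R$ is its negation. The calculus PRC (variable-disjoint premises, displayed literals selected by a selection function satisfying the standard conditions): (Sup) from $(l\approx r\lor C_1)\circ R_1$,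 $(s[l']\doteq t\lor C_2)\circ R_2$ infer $(s[r]\doteq t\lor C_1\lor C_2)\sigma$ with $\sigma=\mathrm{mgu}(l,l')$, $l'$ not a variable, $\sigma\not\models r\succeq l$, $\sigma\not\models t\succeq s[l']$, $\sigma\not\models C_1\succeq l$, $\sigma\not\models C_2\succeq s[l']$ if $s[l']\doteq t$ is positive, $\sigma\not\models R_1$, $\sigma\not\models R_2$. (EqRes) from $(s\not\approx t\lor C)\circ R$ infer $C\sigma$ with $\sigma=\mathrm{mgu}(s,t)$, $\sigma\not\models R$. (EqFac) from $(s\approx t\lor s'\approx t'\lor C)\circ R$ infer $(s\approx t\lor t\not\approx t'\lor C)\sigma$ with $\sigma=\mathrm{mgu}(s,s')$, $\sigma\not\models t\succeq s$, $\sigma\not\models t'\succ t$, $\sigma\not\models C\succ s$, $\sigma\not\models R$. For a set $S$ of partial clauses, $S^*$ is the set of ground instances of clauses $C$ with $(C\circ R)\in S$ for some $R$. A saturation is a sequence $S_0,S_1,\ldots$ of sets of partial clauses, each member of $S_0$ of the form $C\circ\bot$, such that for each $i$ either $S_{i+1}$ is $S_i$ plus $D\circ\bot$ for the conclusion $D$ of a PRC inference with premises in $S_i$, or $S_{i+1}$ arises from $S_i$ by replacing some $C\circ R_1$ by $C\circ(R_1\lor R_2)$ where for every $\theta$ grounding for $C$, $\theta\models R_2$ implies $C\theta$ is redundant w.r.t. $S_i^*$. -}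

module Defs where

open import Data.Nat using (ℕ; zero; suc; _≟_)
open import Data.Fin using (Fin)
open import Data.Bool using (Bool; true; false)
open import Data.Vec using (Vec; []; _∷_; lookup; _[_]≔_)
open import Data.List using (List; []; _∷_; _++_; foldr)
open import Data.List.Relation.Unary.All using (All)
open import Data.List.Relation.Unary.Any using (Any)
open import Data.List.Relation.Binary.Pointwise using (Pointwise)
open import Data.List.Relation.Binary.Permutation.Propositional using (_↭_)
open import Data.List.Membership.Propositional using (_∈_)
open import Data.Product using (Σ; _×_; _,_)
open import Data.Sum using (_⊎_)
open import Data.Empty using (⊥)
open import Relation.Nullary using (¬_; yes; no)
open import Relation.Binary.PropositionalEquality using (_≡_; _≢_)
open import Induction.WellFounded using (WellFounded)
open import Function using (flip)
open import Function.Bundles using (_↔_; _⇔_)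

-- Multiset extension (Dershowitz–Manna) of a relation _>_ on lists read
-- as multisets, where the common part Z/Z' is compared modulo _~_.

MulExt : {A : Set} → (A → A → Set) → (A → A → Set) → List A → List A → Set
MulExt {A} _~_ _>_ M N =
  Σ (List A) λ Z → Σ (List A) λ Z' → Σ (List A) λ X → Σ (List A) λ Y →
    (M ↭ Z ++ X) × (N ↭ Z' ++ Y) × Pointwise _~_ Z Z' × X ≢ [] ×
    All (λ y → Any (λ x → x > y) X) Y

record Signature : Set₁ where
  field
    Fun      : Set
    arity    : Fun → ℕ
    finite   : Σ ℕ (λ n → Fun ↔ Fin n)
    constant : Σ Fun (λ f → arity f ≡ 0)

module Base (Sig : Signature) where
  open Signature Sig

  data Term : Set where
    var : ℕ → Term
    fun : (f : Fun) → Vec Term (arity f) → Term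

  Subst : Set
  Subst = ℕ → Term

  mutual
    sub : Subst → Term → Term
    sub σ (var x)    = σ x
    sub σ (fun f ts) = fun f (subs σ ts)

    subs : ∀ {n} → Subst → Vec Term n → Vec Term n
    subs σ []       = []
    subs σ (t ∷ ts) = sub σ t ∷ subs σ ts

  data _occursIn_ (x : ℕ) : Term → Set where
    here  : x occursIn var x
    inArg : ∀ {f ts} (i : Fin (arity f)) → x occursIn lookup ts i → x occursIn fun f ts

  Ground : Term → Set
  Ground t = ∀ x → ¬ (x occursIn t)

  data Ctx : Set where
    □   : Ctx
    app : (f : Fun) → Fin (arity f) → Vec Term (arity f) → Ctx → Ctx

  plug : Ctx → Term → Term
  plug □ t              = t
  plug (app f i ts c) t = fun f (ts [ i ]≔ plug c t)

  record SimplificationOrder : Set₁ where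
    field
      _≻_          : Term → Term → Set
      trans        : ∀ {s t u} → s ≻ t → t ≻ u → s ≻ u
      irrefl       : ∀ {t} → ¬ (t ≻ t)
      wf           : WellFounded (flip _≻_)
      stable       : ∀ {s t} (σ : Subst) → s ≻ t → sub σ s ≻ sub σ t
      compatible   : ∀ {s t} (c : Ctx) → s ≻ t → plug c s ≻ plug c t
      subterm      : ∀ (c : Ctx) (t : Term) → c ≢ □ → plug c t ≻ t
      total-ground : ∀ s t → Ground s → Ground t → s ≢ t → (s ≻ t) ⊎ (t ≻ s)

  record Literal : Set where
    constructor lit
    field
      pol : Bool
      lhs : Term
      rhs : Term
  open Literal public

  _≈ₗ_ : Term → Term → Literal
  s ≈ₗ t = lit true s t

  _≉ₗ_ : Term → Term → Literal
  s ≉ₗ t = lit false s t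

  -- literals are unordered: equal up to swapping the two sides
  _≐_ : Literal → Literal → Set
  L ≐ K = (pol L ≡ pol K) ×
          (((lhs L ≡ lhs K) × (rhs L ≡ rhs K)) ⊎ ((lhs L ≡ rhs K) × (rhs L ≡ lhs K)))

  Clause : Set
  Clause = List Literal   -- read as a multiset

  subL : Subst → Literal → Literal
  subL σ (lit b s t) = lit b (sub σ s) (sub σ t)

  subC : Subst → Clause → Clause
  subC σ []      = []
  subC σ (L ∷ C) = subL σ L ∷ subC σ C

  occL : ℕ → Literal → Set
  occL x L = (x occursIn lhs L) ⊎ (x occursIn rhs L)

  occC : ℕ → Clause → Set
  occC x C = Any (occL x) C

  GroundingFor : Subst → Clause → Set
  GroundingFor θ C = ∀ x → occC x C → Ground (θ x)

  record Selection : Set where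
    field
      sel     : Clause → List Literal
      sel-sub : ∀ C → Σ Clause (λ rest → C ↭ sel C ++ rest)
      sel-neg : ∀ C → All (λ L → pol L ≡ false) (sel C)

  -- fixed-interpretation predicates of the redundancy-formula language
  -- (besides the built-in = and ≻), finitely many
  record Predicates : Set₁ where
    field
      npred  : ℕ
      parity : Fin npred → ℕ
      interp : (p : Fin npred) → Vec Term (parity p) → Set

  record Structure : Set₁ where
    field
      Carrier : Set
      op      : (f : Fun) → Vec Carrier (arity f) → Carrier

  module _ (M : Structure) where
    open Structure M
    mutual
      eval : (ℕ → Carrier) → Term → Carrier
      eval e (var x)    = e x
      eval e (fun f ts) = op f (evals e ts)

      evals : ∀ {n} → (ℕ → Carrier) → Vec Term n → Vec Carrier n
      evals e []       = []
      evals e (t ∷ ts) = eval e t ∷ evals e ts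

    TrueL : (ℕ → Carrier) → Literal → Set
    TrueL e (lit true s t)  = eval e s ≡ eval e t
    TrueL e (lit false s t) = ¬ (eval e s ≡ eval e t)

    TrueC : Clause → Set
    TrueC C = ∀ (e : ℕ → Carrier) → Any (TrueL e) C

  Entails : List Clause → Clause → Set₁
  Entails Cs D = ∀ (M : Structure) → All (TrueC M) Cs → TrueC M D

module Calculus (Sig : Signature)
                (ord : Base.SimplificationOrder Sig)
                (preds : Base.Predicates Sig)
                (selection : Base.Selection Sig) where
  open Signature Sig
  open Base Sig
  open SimplificationOrder ord
  open Predicates preds
  open Selection selection

  litM : Literal → List Term
  litM (lit true s t)  = s ∷ t ∷ []
  litM (lit false s t) = s ∷ s ∷ t ∷ t ∷ []

  _≻L_ : Literal → Literal → Set
  L ≻L K = MulExt _≡_ _≻_ (litM L) (litM K)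

  _≻C_ : Clause → Clause → Set
  C ≻C D = MulExt _≐_ _≻L_ C D

  Redundant : (Clause → Set) → Clause → Set₁
  Redundant T D = Σ (List Clause) λ Cs →
    All T Cs × Entails Cs D × All (λ C → D ≻C C) Cs

  data Formula : Set where
    ⊥F        : Formula
    _≻F_ _=F_ : Term → Term → Formula
    predF     : (p : Fin npred) → Vec Term (parity p) → Formula
    ¬F_       : Formula → Formula
    _∧F_ _∨F_ : Formula → Formula → Formula
    ∀F ∃F     : ℕ → Formula → Formula

  _[_↦_] : Subst → ℕ → Term → Subst
  (ρ [ x ↦ t ]) y with y ≟ x
  ... | yes _ = t
  ... | no  _ = ρ y

  -- truth in T_R(Σ) under a valuation ρ (variables ↦ ground terms)
  Holds : Subst → Formula → Set
  Holds ρ ⊥F          = ⊥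
  Holds ρ (s ≻F t)    = sub ρ s ≻ sub ρ t
  Holds ρ (s =F t)    = sub ρ s ≡ sub ρ t
  Holds ρ (predF p ts) = interp p (subs ρ ts)
  Holds ρ (¬F φ)      = ¬ Holds ρ φ
  Holds ρ (φ ∧F ψ)    = Holds ρ φ × Holds ρ ψ
  Holds ρ (φ ∨F ψ)    = Holds ρ φ ⊎ Holds ρ ψ
  Holds ρ (∀F x φ)    = ∀ t → Ground t → Holds (ρ [ x ↦ t ]) φ
  Holds ρ (∃F x φ)    = Σ Term λ t → Ground t × Holds (ρ [ x ↦ t ]) φ

  _⊨_ : Subst → Formula → Set
  σ ⊨ R = ∀ (τ : Subst) → (∀ x → Ground (τ x)) → Holds (λ x → sub τ (σ x)) R

  data _freeIn_ (x : ℕ) : Formula → Set where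
    gtˡ  : ∀ {s t} → x occursIn s → x freeIn (s ≻F t)
    gtʳ  : ∀ {s t} → x occursIn t → x freeIn (s ≻F t)
    eqˡ  : ∀ {s t} → x occursIn s → x freeIn (s =F t)
    eqʳ  : ∀ {s t} → x occursIn t → x freeIn (s =F t)
    prd  : ∀ {p ts} (i : Fin (parity p)) → x occursIn lookup ts i → x freeIn predF p ts
    neg  : ∀ {φ} → x freeIn φ → x freeIn (¬F φ)
    andˡ : ∀ {φ ψ} → x freeIn φ → x freeIn (φ ∧F ψ)
    andʳ : ∀ {φ ψ} → x freeIn ψ → x freeIn (φ ∧F ψ)
    orˡ  : ∀ {φ ψ} → x freeIn φ → x freeIn (φ ∨F ψ)
    orʳ  : ∀ {φ ψ} → x freeIn ψ → x freeIn (φ ∨F ψ)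
    all  : ∀ {y φ} → x ≢ y → x freeIn φ → x freeIn (∀F y φ)
    ex   : ∀ {y φ} → x ≢ y → x freeIn φ → x freeIn (∃F y φ)

  _⪰F_ : Term → Term → Formula
  s ⪰F t = (s ≻F t) ∨F (s =F t)

  litGtF : Literal → Term → Formula
  litGtF L l = (lhs L ≻F l) ∨F (rhs L ≻F l)

  litGeF : Literal → Term → Formula
  litGeF L l = (lhs L ⪰F l) ∨F (rhs L ⪰F l)

  clauseGtF : Clause → Term → Formula
  clauseGtF C l = foldr (λ L φ → litGtF L l ∨F φ) ⊥F C

  clauseGeF : Clause → Term → Formula
  clauseGeF C l = foldr (λ L φ → litGeF L l ∨F φ) ⊥F C

  record PClause : Set where
    constructor _⊙_
    field
      cl : Clause
      rf : Formula
  open PClause public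

  WellFormed : PClause → Set
  WellFormed P = ∀ x → x freeIn rf P → occC x (cl P)

  PSet : Set₁
  PSet = PClause → Set

  Star : PSet → Clause → Set
  Star S D = Σ PClause λ P → S P × Σ Subst λ θ → GroundingFor θ (cl P) × D ≡ subC θ (cl P)

  -- variable renamings (bijections on variables); applied to all
  -- variable occurrences, including bound ones (hence capture-free)
  record Renaming : Set where
    field
      π    : ℕ → ℕ
      π⁻¹  : ℕ → ℕ
      inv₁ : ∀ x → π⁻¹ (π x) ≡ x
      inv₂ : ∀ x → π (π⁻¹ x) ≡ x

  module _ (ρ : Renaming) where
    open Renaming ρ
    renT : Term → Term
    renT = sub (λ x → var (π x))

    renF : Formula → Formula
    renF ⊥F           = ⊥F
    renF (s ≻F t)     = renT s ≻F renT t
    renF (s =F t)     = renT s =F renT t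
    renF (predF p ts) = predF p (subs (λ x → var (π x)) ts)
    renF (¬F φ)       = ¬F renF φ
    renF (φ ∧F ψ)     = renF φ ∧F renF ψ
    renF (φ ∨F ψ)     = renF φ ∨F renF ψ
    renF (∀F x φ)     = ∀F (π x) (renF φ)
    renF (∃F x φ)     = ∃F (π x) (renF φ)

    renP : PClause → PClause
    renP (C ⊙ R) = subC (λ x → var (π x)) C ⊙ renF R

  Premise : PSet → PClause → Set
  Premise S P = Σ PClause λ Q → S Q × Σ Renaming λ ρ → P ≡ renP ρ Q

  IsMGU : Subst → Term → Term → Set
  IsMGU σ s t = (sub σ s ≡ sub σ t) ×
    (∀ τ → sub τ s ≡ sub τ t → Σ Subst λ δ → ∀ x → sub δ (σ x) ≡ τ x)

  Eligible : Clause → Literal → Set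
  Eligible C L = (L ∈ sel C) ⊎ (sel C ≡ [])

  data Inference (S : PSet) : Clause → Set where
    sup : ∀ (P₁ P₂ : PClause) → Premise S P₁ → Premise S P₂
        → (∀ x → occC x (cl P₁) → occC x (cl P₂) → ⊥)
        → ∀ (L₁ : Literal) (C₁ : Clause) (l r : Term)
        → cl P₁ ↭ L₁ ∷ C₁ → L₁ ≐ (l ≈ₗ r) → Eligible (cl P₁) L₁
        → ∀ (L₂ : Literal) (C₂ : Clause) (b : Bool) (c : Ctx) (l' t : Term)
        → cl P₂ ↭ L₂ ∷ C₂ → L₂ ≐ lit b (plug c l') t → Eligible (cl P₂) L₂
        → (∀ x → l' ≢ var x)
        → (σ : Subst) → IsMGU σ l l'
        → ¬ (σ ⊨ (r ⪰F l))
        → ¬ (σ ⊨ (t ⪰F plug c l'))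
        → ¬ (σ ⊨ clauseGeF C₁ l)
        → (b ≡ true → ¬ (σ ⊨ clauseGeF C₂ (plug c l')))
        → ¬ (σ ⊨ rf P₁) → ¬ (σ ⊨ rf P₂)
        → Inference S (subC σ (lit b (plug c r) t ∷ C₁ ++ C₂))
    eqres : ∀ (P : PClause) → Premise S P
          → ∀ (L : Literal) (C : Clause) (s t : Term)
          → cl P ↭ L ∷ C → L ≐ (s ≉ₗ t) → Eligible (cl P) L
          → (σ : Subst) → IsMGU σ s t
          → ¬ (σ ⊨ rf P)
          → Inference S (subC σ C)
    eqfac : ∀ (P : PClause) → Premise S P
          → ∀ (L L' : Literal) (C : Clause) (s t s' t' : Term)
          → cl P ↭ L ∷ L' ∷ C → L ≐ (s ≈ₗ t) → L' ≐ (s' ≈ₗ t')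
          → Eligible (cl P) L → Eligible (cl P) L'
          → (σ : Subst) → IsMGU σ s s'
          → ¬ (σ ⊨ (t ⪰F s))
          → ¬ (σ ⊨ (t' ≻F t))
          → ¬ (σ ⊨ clauseGtF C s)
          → ¬ (σ ⊨ rf P)
          → Inference S (subC σ ((s ≈ₗ t) ∷ (t ≉ₗ t') ∷ C))

  InfStep : PSet → PSet → Set
  InfStep S S' = Σ Clause λ D → Inference S D ×
    (∀ P → S' P ⇔ (S P ⊎ P ≡ (D ⊙ ⊥F)))

  RedStep : PSet → PSet → Set₁
  RedStep S S' = Σ Clause λ C → Σ Formula λ R₁ → Σ Formula λ R₂ →
    S (C ⊙ R₁) × WellFormed (C ⊙ R₂) ×
    (∀ θ → GroundingFor θ C → θ ⊨ R₂ → Redundant (Star S) (subC θ C)) ×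
    (∀ P → S' P ⇔ ((S P × P ≢ (C ⊙ R₁)) ⊎ P ≡ (C ⊙ (R₁ ∨F R₂))))

  record Saturation (S : ℕ → PSet) : Set₁ where
    field
      initial : ∀ P → S 0 P → rf P ≡ ⊥F
      step    : ∀ i → InfStep (S i) (S (suc i)) ⊎ RedStep (S i) (S (suc i))

-- A partial clause C ⊙ R
-- enters either with R = ⊥, which no substitution satisfies because the
-- signature has a ground term, or by weakening C ⊙ R₁ to C ⊙ (R₁ ∨ R₂), where
-- R₂ is justified by redundancy w.r.t. S*ᵢ. Since the free variables of R
-- occur in C, for θ grounding C the formula Rθ is closed: θ ⊨ R is decided
-- by a single ground instance, so θ ⊨ R₁ ∨ R₂ splits into θ ⊨ R₁ (use the
-- induction hypothesis) or θ ⊨ R₂ (use the justification). Finally S*ᵢ only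
-- grows along the saturation, and redundancy is monotone in the set.
module Submission where

open import Defs
open import Data.Nat using (ℕ; zero; suc; _≟_)
open import Data.Fin using (Fin; zero; suc)
open import Data.Fin.Properties using (inj⇒≟)
open import Data.Vec using (Vec; []; _∷_; lookup)
open import Data.List.Properties using (≡-dec)
import Data.List.Relation.Unary.All as All
import Data.Bool.Properties as Bool
open import Data.Product using (_,_; proj₁; proj₂)
open import Data.Sum using (_⊎_; inj₁; inj₂)
open import Data.Empty using (⊥-elim)
open import Function using (_∘_)
open import Function.Bundles using (Equivalence)
open import Function.Properties.Inverse using (↔⇒↣)
open import Relation.Nullary using (¬_; yes; no)
open import Relation.Binary.Definitions using (DecidableEquality)
open import Relation.Binary.PropositionalEquality

module Soundness (Sig : Signature) (ord : Base.SimplificationOrder Sig)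
                 (preds : Base.Predicates Sig) (selection : Base.Selection Sig) where
  open Signature Sig
  open Base Sig
  open SimplificationOrder ord using (_≻_)
  open Predicates preds
  open Calculus Sig ord preds selection

  _≟ᶠ_ : DecidableEquality Fun
  _≟ᶠ_ = inj⇒≟ (↔⇒↣ (proj₂ finite))

  mutual
    _≟ₜ_ : DecidableEquality Term
    var x ≟ₜ var y with x ≟ y
    ... | yes refl = yes refl
    ... | no x≢y   = no λ { refl → x≢y refl }
    var x ≟ₜ fun g us = no λ ()
    fun f ts ≟ₜ var y = no λ ()
    fun f ts ≟ₜ fun g us with f ≟ᶠ g
    ... | no f≢g = no λ { refl → f≢g refl }
    ... | yes refl with ts ≟ᵥ us
    ...   | yes refl  = yes refl
    ...   | no ts≢us  = no λ { refl → ts≢us refl }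

    _≟ᵥ_ : ∀ {n} → DecidableEquality (Vec Term n)
    [] ≟ᵥ [] = yes refl
    (t ∷ ts) ≟ᵥ (u ∷ us) with t ≟ₜ u | ts ≟ᵥ us
    ... | yes refl | yes refl = yes refl
    ... | no t≢u   | _        = no λ { refl → t≢u refl }
    ... | yes _    | no ts≢us = no λ { refl → ts≢us refl }

  _≟ₗ_ : DecidableEquality Literal
  lit b s t ≟ₗ lit b' s' t' with b Bool.≟ b' | s ≟ₜ s' | t ≟ₜ t'
  ... | yes refl | yes refl | yes refl = yes refl
  ... | no b≢b'  | _        | _        = no λ { refl → b≢b' refl }
  ... | yes _    | no s≢s'  | _        = no λ { refl → s≢s' refl }
  ... | yes _    | yes _    | no t≢t'  = no λ { refl → t≢t' refl }

  _≟ᶜ_ : DecidableEquality Clause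
  _≟ᶜ_ = ≡-dec _≟ₗ_

  mutual
    sub-cong-occurs : ∀ ρ ρ' t → (∀ x → x occursIn t → ρ x ≡ ρ' x) → sub ρ t ≡ sub ρ' t
    sub-cong-occurs ρ ρ' (var x)    agree = agree x here
    sub-cong-occurs ρ ρ' (fun f ts) agree =
      cong (fun f) (subs-cong-occurs ρ ρ' ts λ i x o → agree x (inArg i o))

    subs-cong-occurs : ∀ {n} ρ ρ' (ts : Vec Term n) →
                       (∀ i x → x occursIn lookup ts i → ρ x ≡ ρ' x) → subs ρ ts ≡ subs ρ' ts
    subs-cong-occurs ρ ρ' []       agree = refl
    subs-cong-occurs ρ ρ' (t ∷ ts) agree =
      cong₂ _∷_ (sub-cong-occurs ρ ρ' t (agree zero)) (subs-cong-occurs ρ ρ' ts (agree ∘ suc))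

  sub-ground : ∀ ρ ρ' {t} → Ground t → sub ρ t ≡ sub ρ' t
  sub-ground ρ ρ' {t} ground = sub-cong-occurs ρ ρ' t λ x o → ⊥-elim (ground x o)

  ↦-cong : ∀ ρ ρ' y t {x} → (x ≢ y → ρ x ≡ ρ' x) → (ρ [ y ↦ t ]) x ≡ (ρ' [ y ↦ t ]) x
  ↦-cong ρ ρ' y t {x} agree with x ≟ y
  ... | yes _   = refl
  ... | no x≢y  = agree x≢y

  Holds-cong-free : ∀ ρ ρ' φ → (∀ x → x freeIn φ → ρ x ≡ ρ' x) → Holds ρ φ → Holds ρ' φ
  Holds-cong-free ρ ρ' ⊥F         agree ()
  Holds-cong-free ρ ρ' (s ≻F t)   agree =
    subst₂ _≻_ (sub-cong-occurs ρ ρ' s (λ x → agree x ∘ gtˡ))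
               (sub-cong-occurs ρ ρ' t (λ x → agree x ∘ gtʳ))
  Holds-cong-free ρ ρ' (s =F t)   agree s≡t = begin
    sub ρ' s ≡⟨ sub-cong-occurs ρ ρ' s (λ x → agree x ∘ eqˡ) ⟨
    sub ρ s  ≡⟨ s≡t ⟩
    sub ρ t  ≡⟨ sub-cong-occurs ρ ρ' t (λ x → agree x ∘ eqʳ) ⟩
    sub ρ' t ∎
    where open ≡-Reasoning
  Holds-cong-free ρ ρ' (predF p ts) agree =
    subst (interp p) (subs-cong-occurs ρ ρ' ts λ i x → agree x ∘ prd i)
  Holds-cong-free ρ ρ' (¬F φ)     agree ¬φ φ' =
    ¬φ (Holds-cong-free ρ' ρ φ (λ x f → sym (agree x (neg f))) φ')
  Holds-cong-free ρ ρ' (φ ∧F ψ)   agree (hφ , hψ) =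
    Holds-cong-free ρ ρ' φ (λ x → agree x ∘ andˡ) hφ ,
    Holds-cong-free ρ ρ' ψ (λ x → agree x ∘ andʳ) hψ
  Holds-cong-free ρ ρ' (φ ∨F ψ)   agree (inj₁ hφ) =
    inj₁ (Holds-cong-free ρ ρ' φ (λ x → agree x ∘ orˡ) hφ)
  Holds-cong-free ρ ρ' (φ ∨F ψ)   agree (inj₂ hψ) =
    inj₂ (Holds-cong-free ρ ρ' ψ (λ x → agree x ∘ orʳ) hψ)
  Holds-cong-free ρ ρ' (∀F y φ)   agree h t ground =
    Holds-cong-free (ρ [ y ↦ t ]) (ρ' [ y ↦ t ]) φ
      (λ x f → ↦-cong ρ ρ' y t λ x≢y → agree x (all x≢y f)) (h t ground)
  Holds-cong-free ρ ρ' (∃F y φ)   agree (t , ground , h) =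
    t , ground , Holds-cong-free (ρ [ y ↦ t ]) (ρ' [ y ↦ t ]) φ
                   (λ x f → ↦-cong ρ ρ' y t λ x≢y → agree x (ex x≢y f)) h

  c₀ : Term
  c₀ = fun (proj₁ constant) (subst (Vec Term) (sym (proj₂ constant)) [])

  c₀-ground : Ground c₀
  c₀-ground x (inArg i _) with subst Fin (proj₂ constant) i
  ... | ()

  ⊨⇒Holds-c₀ : ∀ {θ R} → θ ⊨ R → Holds (sub (λ _ → c₀) ∘ θ) R
  ⊨⇒Holds-c₀ θ⊨R = θ⊨R (λ _ → c₀) (λ _ → c₀-ground)

  ¬⊨⊥F : ∀ θ → ¬ (θ ⊨ ⊥F)
  ¬⊨⊥F θ = ⊨⇒Holds-c₀ {θ} {⊥F}

  Holds-c₀⇒⊨ : ∀ {C R θ} → WellFormed (C ⊙ R) → GroundingFor θ C →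
               Holds (sub (λ _ → c₀) ∘ θ) R → θ ⊨ R
  Holds-c₀⇒⊨ {R = R} wf grounding h τ _ =
    Holds-cong-free _ _ R (λ x f → sub-ground _ τ (grounding x (wf x f))) h

  ⊨-∨F-split : ∀ {C R₁ R₂ θ} → WellFormed (C ⊙ (R₁ ∨F R₂)) → GroundingFor θ C →
               θ ⊨ (R₁ ∨F R₂) → θ ⊨ R₁ ⊎ θ ⊨ R₂
  ⊨-∨F-split {R₁ = R₁} {R₂} {θ} wf grounding θ⊨R with ⊨⇒Holds-c₀ {θ} {R₁ ∨F R₂} θ⊨R
  ... | inj₁ h₁ = inj₁ (Holds-c₀⇒⊨ (λ x → wf x ∘ orˡ) grounding h₁)
  ... | inj₂ h₂ = inj₂ (Holds-c₀⇒⊨ (λ x → wf x ∘ orʳ) grounding h₂)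

  Redundant-mono : ∀ {T T' : Clause → Set} {D} → (∀ {E} → T E → T' E) →
                   Redundant T D → Redundant T' D
  Redundant-mono T⊆T' (Cs , Cs∈T , Cs⊨D , D≻Cs) = Cs , All.map T⊆T' Cs∈T , Cs⊨D , D≻Cs

  module _ {S : ℕ → PSet} (sat : Saturation S) where
    open Saturation sat

    wellFormed : ∀ i {P} → S i P → WellFormed P
    wellFormed zero {P} P∈S₀ x rewrite initial P P∈S₀ = λ ()
    wellFormed (suc i) {P} P∈S with step i
    ... | inj₁ (_ , _ , S′≡) with Equivalence.to (S′≡ P) P∈S
    ...   | inj₁ P∈Sᵢ = wellFormed i P∈Sᵢ
    ...   | inj₂ refl = λ x ()
    wellFormed (suc i) {P} P∈S | inj₂ (_ , _ , _ , C⊙R₁∈Sᵢ , wf₂ , _ , S′≡)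
      with Equivalence.to (S′≡ P) P∈S
    ...   | inj₁ (P∈Sᵢ , _) = wellFormed i P∈Sᵢ
    ...   | inj₂ refl = λ { x (orˡ f) → wellFormed i C⊙R₁∈Sᵢ x f ; x (orʳ f) → wf₂ x f }

    Star-mono : ∀ i {D} → Star (S i) D → Star (S (suc i)) D
    Star-mono i (P , P∈Sᵢ , θ , grounding , D≡) with step i
    ... | inj₁ (_ , _ , S′≡) = P , Equivalence.from (S′≡ P) (inj₁ P∈Sᵢ) , θ , grounding , D≡
    ... | inj₂ (C , R₁ , R₂ , _ , _ , _ , S′≡) with cl P ≟ᶜ C
    ...   | yes refl = C ⊙ (R₁ ∨F R₂) , Equivalence.from (S′≡ _) (inj₂ refl) , θ , grounding , D≡
    ...   | no P≢C   = P , Equivalence.from (S′≡ P) (inj₁ (P∈Sᵢ , P≢C ∘ cong cl)) ,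
                       θ , grounding , D≡

    instance-redundant : ∀ i C R → S i (C ⊙ R) → ∀ θ → GroundingFor θ C → θ ⊨ R →
                         Redundant (Star (S i)) (subC θ C)
    instance-redundant zero C R C⊙R∈S₀ θ _ θ⊨R rewrite initial _ C⊙R∈S₀ = ⊥-elim (¬⊨⊥F θ θ⊨R)
    instance-redundant (suc i) C R C⊙R∈S θ grounding θ⊨R with step i
    ... | inj₁ (_ , _ , S′≡) with Equivalence.to (S′≡ _) C⊙R∈S
    ...   | inj₁ C⊙R∈Sᵢ = Redundant-mono (Star-mono i)
                            (instance-redundant i C R C⊙R∈Sᵢ θ grounding θ⊨R)
    ...   | inj₂ refl   = ⊥-elim (¬⊨⊥F θ θ⊨R)
    instance-redundant (suc i) C R C⊙R∈S θ grounding θ⊨R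
      | inj₂ (_ , R₁ , _ , C⊙R₁∈Sᵢ , _ , justified , S′≡) with Equivalence.to (S′≡ _) C⊙R∈S
    ...   | inj₁ (C⊙R∈Sᵢ , _) = Redundant-mono (Star-mono i)
                                  (instance-redundant i C R C⊙R∈Sᵢ θ grounding θ⊨R)
    ...   | inj₂ refl with ⊨-∨F-split (wellFormed (suc i) C⊙R∈S) grounding θ⊨R
    ...     | inj₁ θ⊨R₁ = Redundant-mono (Star-mono i)
                            (instance-redundant i C R₁ C⊙R₁∈Sᵢ θ grounding θ⊨R₁)
    ...     | inj₂ θ⊨R₂ = Redundant-mono (Star-mono i) (justified θ grounding θ⊨R₂)

lemma4 : (Sig : Signature) (ord : Base.SimplificationOrder Sig)
         (preds : Base.Predicates Sig) (selection : Base.Selection Sig)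
         → let open Base Sig in let open Calculus Sig ord preds selection in
           (S : ℕ → PSet) → Saturation S →
           ∀ (i : ℕ) (C : Clause) (R : Formula) → S i (C ⊙ R) →
           ∀ (θ : Subst) → GroundingFor θ C → θ ⊨ R →
           Redundant (Star (S i)) (subC θ C)
lemma4 Sig ord preds selection S = Soundness.instance-redundant Sig ord preds selection
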